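{- Let $(V,d_2)$ be a $2$-metric space and let $v_1,v_2,v_3\in V$ be distinct points with $d_2(v_1,v_2,v_3)=1$. Fix an integer $r\ge 1$ and $0<\tau<1/3$, and consider the following random request sequence for the $3$-MPMD problem: let pattern $P_1$ consist of three requests at $v_1$ and pattern $P_2$ consist of one request at each of $v_1,v_2,v_3$. There are phases $i=1,\dots,r$, consecutive phases being separated by time $1$. In phase $i$: the three requests of $P_1$ arrive simultaneously; after waiting time $\tau$, a Bernoulli random variable $C_i$ with $P(C_i=1)=\frac{1}{r-i+1}$ is sampled; if $C_i=1$ the requests of $P_2$ arrive (at that moment) and the sequence terminates, otherwise the next phase begins. Then the cost of the optimal offline algorithm on every request sequence in the support of this distribution is $3\tau$.
   Context: $3$-MPMD problem: given a generalized metric $d:V^3\to[0,\infty)$, requests $\rho$ with location $\ell(\rho)\in V$ and arrival time $t(\rho)$ must be partitioned into sets of exactly $3$ requests; matching $\{\rho_1,\rho_2,\rho_3\}$ costs $d(\ell(\rho_1),\ell(\rho_2),\ell(\rho_3))$ (space cost) and each request matched at time $t'(\rho)$ costs $t'(\rho)-t(\rho)$ (time cost); the optimal offline algorithm knows the whole sequence in advance and minimizes the total cost. A $2$-metric on $V$ is a function $d:V^3\to[0,\infty)$ such that for all $v_1,v_2,v_3,a\in V$: ($\Pi$) $d$ is invariant under permutations of its arguments; ($O_2$) $d(v_1,v_2,v_3)=0$ if and only if at least two of $v_1,v_2,v_3$ are equal, and $d(v_1,v_2,v_3)>0$ otherwise; ($\Delta_D$) $d(v_1,v_2,v_3)\le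 d(v_1,v_2,a)+d(v_1,a,v_3)+d(a,v_2,v_3)$.
   Formalization: The 2-metric takes values in the nonnegative rationals, and the waiting time τ, the arrival times and the matching times are rational rather than real. -}

module Defs where

open import Data.Nat as ℕ using (ℕ; zero; suc)
open import Data.Integer using (+_)
open import Data.Rational using (ℚ; 0ℚ; _+_; _-_; _*_; _≤_; _<_; _/_)
open import Data.Fin using (Fin)
open import Data.List using (List; []; _∷_; _++_; length; lookup; concatMap; allFin; foldr)
open import Data.List.Relation.Binary.Permutation.Propositional using (_↭_)
open import Data.Product using (Σ; _×_; _,_; ∃)
open import Data.Sum using (_⊎_)
open import Relation.Binary.PropositionalEquality using (_≡_)
open import Relation.Nullary using (¬_)
open import Data.List.Relation.Unary.All using (All)

ℕ→ℚ : ℕ → ℚ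
ℕ→ℚ n = + n / 1

TwoEqual : ∀ {a} {V : Set a} → V → V → V → Set a
TwoEqual x y z = (x ≡ y) ⊎ (x ≡ z) ⊎ (y ≡ z)

record Is2Metric {a} {V : Set a} (d : V → V → V → ℚ) : Set a where
  field
    nonneg : ∀ x y z → 0ℚ ≤ d x y z
    -- (Π) invariance under permutations (generated by these two transpositions)
    perm₁₂ : ∀ x y z → d x y z ≡ d y x z
    perm₂₃ : ∀ x y z → d x y z ≡ d x z y
    zero-if   : ∀ x y z → TwoEqual x y z → d x y z ≡ 0ℚ
    zero-only : ∀ x y z → d x y z ≡ 0ℚ → TwoEqual x y z
    pos       : ∀ x y z → ¬ TwoEqual x y z → 0ℚ < d x y z
    tetra : ∀ x y z w → d x y z ≤ d x y w + d x w z + d w y z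

record Request {a} (V : Set a) : Set a where
  constructor req
  field
    loc  : V
    time : ℚ
open Request public

record Triple (n : ℕ) : Set where
  constructor tri
  field
    i₁ i₂ i₃ : Fin n
    mtime    : ℚ
open Triple public

indices : ∀ {n} → List (Triple n) → List (Fin n)
indices = concatMap (λ t → i₁ t ∷ i₂ t ∷ i₃ t ∷ [])

module _ {a} {V : Set a} (d : V → V → V → ℚ) (σ : List (Request V)) where
  private
    n = length σ
    R : Fin n → Request V
    R = lookup σ

  TripleFeasible : Triple n → Set
  TripleFeasible t = (time (R (i₁ t)) ≤ mtime t) × (time (R (i₂ t)) ≤ mtime t) × (time (R (i₃ t)) ≤ mtime t)

  -- a (complete, offline) solution of 3-MPMD: a partition of all requests into
  -- sets of exactly three, each matched no earlier than the arrival of its requests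
  IsSolution : List (Triple n) → Set
  IsSolution M = (indices M ↭ allFin n) × All TripleFeasible M

  tripleCost : Triple n → ℚ
  tripleCost t = d (loc (R (i₁ t))) (loc (R (i₂ t))) (loc (R (i₃ t)))
               + ((mtime t - time (R (i₁ t))) + (mtime t - time (R (i₂ t))) + (mtime t - time (R (i₃ t))))

  cost : List (Triple n) → ℚ
  cost = foldr (λ t c → tripleCost t + c) 0ℚ

  OptCost : ℚ → Set
  OptCost c = (Σ (List (Triple n)) λ M → IsSolution M × cost M ≡ c)
            × (∀ M → IsSolution M → c ≤ cost M)

-- The request sequence of the lower-bound distribution that terminates in phase k
-- (k ≥ 1). Phase i (i = 1,…,k) starts at time i-1; P₁ (three requests at v₁)
-- arrives at its start; in the final phase k, P₂ (one request at each of v₁,v₂,v₃)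
-- arrives τ later.
module _ {a} {V : Set a} where
  P₁ : V → ℚ → List (Request V)
  P₁ v₁ s = req v₁ s ∷ req v₁ s ∷ req v₁ s ∷ []

  P₂ : V → V → V → ℚ → List (Request V)
  P₂ v₁ v₂ v₃ s = req v₁ s ∷ req v₂ s ∷ req v₃ s ∷ []

  P₁phases : V → ℕ → List (Request V)
  P₁phases v₁ zero    = []
  P₁phases v₁ (suc m) = P₁phases v₁ m ++ P₁ v₁ (ℕ→ℚ m)

  requestSeq : V → V → V → ℚ → ℕ → List (Request V)
  requestSeq v₁ v₂ v₃ τ k = P₁phases v₁ k ++ P₂ v₁ v₂ v₃ (ℕ→ℚ (k ℕ.∸ 1) + τ)

-- The upper bound matches each of the first k − 1 copies of P₁ among themselves on arrival, at no
-- cost, and in the last phase matches two requests of P₁ with the new request at v₂ and the third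
-- with the new requests at v₁ and v₃, all at time T = (k − 1) + τ. Since d vanishes as soon as two
-- points coincide, only the waiting times 2τ + τ remain.
-- For the lower bound, let a and b be the new requests at v₂ and v₃ and w the new one at v₁; every
-- other request lies at v₁ and arrived at least τ before T. If a and b share a triple, its third
-- request lies at v₁, so it costs at least d(v₁,v₂,v₃) = 1 ≥ 3τ. Otherwise the triples of a and b
-- are disjoint and matched no earlier than T, and of the four other requests in them only w can
-- have arrived less than τ before T, so their waiting times add up to at least 3τ.
module Submission where

open import Defs
open import Data.Nat using (ℕ; _≤_)
open import Data.Integer using (+_)
open import Data.Rational using (ℚ; 0ℚ; 1ℚ; _<_; _/_; _*_)
open import Relation.Binary.PropositionalEquality using (_≡_; _≢_)

open import Level using (Level; 0ℓ)
open import Function using (_∘_; id)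
open import Data.Empty using (⊥-elim)
open import Data.Product using (∃; ∃₂; Σ; _×_; _,_)
import Data.Product as Product
open import Data.Sum using (_⊎_; inj₁; inj₂)
import Data.Sum as Sum
open import Relation.Nullary using (Dec; yes; no)
open import Relation.Nullary.Decidable using (dec⇒maybe)
open import Relation.Binary.PropositionalEquality
  using (refl; sym; trans; cong; cong₂; subst; subst₂; setoid; module ≡-Reasoning)

import Data.Nat as ℕ
import Data.Nat.Properties as ℕ
import Data.Integer as ℤ
import Data.Integer.Properties as ℤ
open import Data.Nat.Coprimality using (1-coprimeTo) renaming (sym to coprime-sym)
open import Data.Fin using (Fin; zero; suc; _↑ʳ_; #_) renaming (_≟_ to _≟ᶠ_)
open import Data.Rational using (_+_; _-_; -_; *≤*) renaming (_≤_ to _≤ℚ_)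
open import Data.Rational.Properties
  using (≤-refl; ≤-trans; <⇒≤; +-mono-≤; +-monoˡ-≤; +-monoʳ-≤; +-mono-<;
         +-comm; +-identityˡ; +-identityʳ; normalize-coprime; +-*-commutativeRing;
         +-0-commutativeMonoid; module ≤-Reasoning)
  renaming (_≟_ to _≟ℚ_)
open import Algebra.Bundles using (CommutativeMonoid)
open import Algebra.Properties.CommutativeSemigroup
  (CommutativeMonoid.commutativeSemigroup +-0-commutativeMonoid) using (xy∙z≈xz∙y)
open import Tactic.RingSolver using (solve-∀)
open import Tactic.RingSolver.Core.AlmostCommutativeRing
  using (AlmostCommutativeRing; fromCommutativeRing)

open import Data.List using (List; []; _∷_; _++_; foldr; concatMap; length; lookup; allFin; map)
open import Data.List.Properties using (++-assoc; map-tabulate)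
open import Data.List.Relation.Unary.All as All using (All; []; _∷_)
import Data.List.Relation.Unary.All.Properties as All
open import Data.List.Relation.Unary.Any using (here; there)
open import Data.List.Relation.Unary.AllPairs using ([]; _∷_)
open import Data.List.Relation.Unary.Unique.Propositional using (Unique)
open import Data.List.Relation.Unary.Unique.Propositional.Properties using (allFin⁺)
open import Data.List.Membership.Propositional using (_∈_; lose; find)
open import Data.List.Membership.Propositional.Properties
  using (∈-++⁺ʳ; ∈-concatMap⁺; ∈-concatMap⁻; ∈-allFin)
import Data.List.Membership.DecPropositional as DecMembership
open import Data.List.Relation.Binary.Disjoint.Propositional using (Disjoint)
open import Data.List.Relation.Binary.Permutation.Propositional
  using (_↭_; ↭-refl; ↭-prep; ↭-swap; ↭-trans; ↭-sym; ↭⇒↭ₛ; module PermutationReasoning)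
open import Data.List.Relation.Binary.Permutation.Propositional.Properties
  using (∈-resp-↭; All-resp-↭; map⁺)
import Data.List.Relation.Binary.Permutation.Setoid.Properties as Permutationₛ

private
  variable
    ℓ : Level
    A : Set ℓ
    p q r : ℚ

ℚ-ring : AlmostCommutativeRing 0ℓ 0ℓ
ℚ-ring = fromCommutativeRing +-*-commutativeRing (λ x → dec⇒maybe (0ℚ ≟ℚ x))

p≤q+p : 0ℚ ≤ℚ q → p ≤ℚ q + p
p≤q+p {q} {p} 0≤q = subst (_≤ℚ q + p) (+-identityˡ p) (+-monoˡ-≤ p 0≤q)

p≤p+q : 0ℚ ≤ℚ q → p ≤ℚ p + q
p≤p+q {q} {p} 0≤q = subst (p ≤ℚ_) (+-comm q p) (p≤q+p 0≤q)

p+r≤q⇒r≤q-p : p + r ≤ℚ q → r ≤ℚ q - p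
p+r≤q⇒r≤q-p {p} {r} {q} p+r≤q = subst (_≤ℚ q - p) (p+r-p≡r p r) (+-monoˡ-≤ (- p) p+r≤q)
  where
    p+r-p≡r : ∀ p r → p + r - p ≡ r
    p+r-p≡r = solve-∀ ℚ-ring

p≤q⇒0≤q-p : p ≤ℚ q → 0ℚ ≤ℚ q - p
p≤q⇒0≤q-p {p} p≤q = p+r≤q⇒r≤q-p (subst (_≤ℚ _) (sym (+-identityʳ p)) p≤q)

ℕ→ℚ-mono-≤ : ∀ {m n} → m ≤ n → ℕ→ℚ m ≤ℚ ℕ→ℚ n
ℕ→ℚ-mono-≤ {m} {n} m≤n
  rewrite normalize-coprime (coprime-sym (1-coprimeTo m))
        | normalize-coprime (coprime-sym (1-coprimeTo n))
  = *≤* (subst₂ ℤ._≤_ (sym (ℤ.*-identityʳ (+ m))) (sym (ℤ.*-identityʳ (+ n))) (ℤ.+≤+ m≤n))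

3*τ≡τ+τ+τ : ∀ τ → ℕ→ℚ 3 * τ ≡ τ + τ + τ
3*τ≡τ+τ+τ = solve-∀ ℚ-ring

3*τ≡τ+[τ+τ] : ∀ τ → ℕ→ℚ 3 * τ ≡ τ + (τ + τ)
3*τ≡τ+[τ+τ] = solve-∀ ℚ-ring

3*τ≤1 : ∀ {τ} → τ < + 1 / 3 → ℕ→ℚ 3 * τ ≤ℚ 1ℚ
3*τ≤1 {τ} τ<⅓ = subst (_≤ℚ 1ℚ) (sym (3*τ≡τ+τ+τ τ)) (<⇒≤ (+-mono-< (+-mono-< τ<⅓ τ<⅓) τ<⅓))

∑ : (A → ℚ) → List A → ℚ
∑ f = foldr (λ x s → f x + s) 0ℚ

module _ {f : A → ℚ} where

  ∑-nonNeg : ∀ {xs} → All (λ x → 0ℚ ≤ℚ f x) xs → 0ℚ ≤ℚ ∑ f xs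
  ∑-nonNeg []              = ≤-refl
  ∑-nonNeg (0≤fx ∷ nonNeg) = +-mono-≤ 0≤fx (∑-nonNeg nonNeg)

  ∑-≥-term : ∀ {x xs} → All (λ x → 0ℚ ≤ℚ f x) xs → x ∈ xs → f x ≤ℚ ∑ f xs
  ∑-≥-term (_    ∷ nonNeg) (here refl) = p≤p+q (∑-nonNeg nonNeg)
  ∑-≥-term (0≤fy ∷ nonNeg) (there x∈)  = ≤-trans (∑-≥-term nonNeg x∈) (p≤q+p 0≤fy)

  ∑-≥-two-terms : ∀ {x y xs} → All (λ x → 0ℚ ≤ℚ f x) xs → x ∈ xs → y ∈ xs → x ≢ y →
                  f x + f y ≤ℚ ∑ f xs
  ∑-≥-two-terms _ (here refl) (here refl) x≢y = ⊥-elim (x≢y refl)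
  ∑-≥-two-terms {x} (_ ∷ nonNeg) (here refl) (there y∈) _ = +-monoʳ-≤ (f x) (∑-≥-term nonNeg y∈)
  ∑-≥-two-terms {x} {y} (_ ∷ nonNeg) (there x∈) (here refl) _ =
    subst (_≤ℚ _) (+-comm (f y) (f x)) (+-monoʳ-≤ (f y) (∑-≥-term nonNeg x∈))
  ∑-≥-two-terms (0≤fz ∷ nonNeg) (there x∈) (there y∈) x≢y =
    ≤-trans (∑-≥-two-terms nonNeg x∈ y∈ x≢y) (p≤q+p 0≤fz)

Unique-resp-↭ : ∀ {xs ys : List A} → xs ↭ ys → Unique xs → Unique ys
Unique-resp-↭ = Permutationₛ.Unique-resp-↭ (setoid _) ∘ ↭⇒↭ₛ

Unique-++⁻ˡ : ∀ (xs : List A) {ys} → Unique (xs ++ ys) → Unique xs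
Unique-++⁻ˡ []       _        = []
Unique-++⁻ˡ (x ∷ xs) (x∉ ∷ u) = All.++⁻ˡ xs x∉ ∷ Unique-++⁻ˡ xs u

Unique-++⁻ʳ : ∀ (xs : List A) {ys} → Unique (xs ++ ys) → Unique ys
Unique-++⁻ʳ []       u       = u
Unique-++⁻ʳ (x ∷ xs) (_ ∷ u) = Unique-++⁻ʳ xs u

Unique-++⇒Disjoint : ∀ (xs : List A) {ys} → Unique (xs ++ ys) → Disjoint xs ys
Unique-++⇒Disjoint (x ∷ xs) (x∉ ∷ _) (here refl , z∈ys) = All.lookup x∉ (∈-++⁺ʳ xs z∈ys) refl
Unique-++⇒Disjoint (x ∷ xs) (_ ∷ u)  (there z∈xs , z∈ys) = Unique-++⇒Disjoint xs u (z∈xs , z∈ys)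

module _ {b} {B : Set b} (f : A → List B) where

  Unique-concatMap⁻ : ∀ {xs x} → Unique (concatMap f xs) → x ∈ xs → Unique (f x)
  Unique-concatMap⁻ {x ∷ _}  u (here refl) = Unique-++⁻ˡ (f x) u
  Unique-concatMap⁻ {y ∷ _}  u (there x∈)  = Unique-concatMap⁻ (Unique-++⁻ʳ (f y) u) x∈

  Unique-concatMap⇒Disjoint : ∀ {xs x y} → Unique (concatMap f xs) → x ∈ xs → y ∈ xs → x ≢ y →
                              Disjoint (f x) (f y)
  Unique-concatMap⇒Disjoint _ (here refl) (here refl) x≢y = ⊥-elim (x≢y refl)
  Unique-concatMap⇒Disjoint {x ∷ _} u (here refl) (there y∈) _ (z∈fx , z∈fy) =
    Unique-++⇒Disjoint (f x) u (z∈fx , ∈-concatMap⁺ f (lose y∈ z∈fy))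
  Unique-concatMap⇒Disjoint {y ∷ _} u (there x∈) (here refl) _ (z∈fx , z∈fy) =
    Unique-++⇒Disjoint (f y) u (z∈fy , ∈-concatMap⁺ f (lose x∈ z∈fx))
  Unique-concatMap⇒Disjoint {z ∷ _} u (there x∈) (there y∈) x≢y =
    Unique-concatMap⇒Disjoint (Unique-++⁻ʳ (f z) u) x∈ y∈ x≢y

index-++ʳ : ∀ (xs : List A) {ys} → Fin (length ys) → Fin (length (xs ++ ys))
index-++ʳ []       j = j
index-++ʳ (_ ∷ xs) j = suc (index-++ʳ xs j)

lookup-index-++ʳ : ∀ (xs : List A) {ys} (j : Fin (length ys)) →
                   lookup (xs ++ ys) (index-++ʳ xs j) ≡ lookup ys j
lookup-index-++ʳ []       j = refl
lookup-index-++ʳ (_ ∷ xs) j = lookup-index-++ʳ xs j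

lookup-++-cases : ∀ {ℓ′} {P : A → Set ℓ′} {xs ys} → All P xs → (i : Fin (length (xs ++ ys))) →
                  P (lookup (xs ++ ys) i) ⊎ ∃ λ j → i ≡ index-++ʳ xs j
lookup-++-cases []         i       = inj₂ (i , refl)
lookup-++-cases (px ∷ _)   zero    = inj₁ px
lookup-++-cases (_  ∷ pxs) (suc i) = Sum.map₂ (Product.map₂ (cong suc)) (lookup-++-cases pxs i)

module Matching {V : Set ℓ} {d : V → V → V → ℚ} (metric : Is2Metric d) (σ : List (Request V)) where
  open Is2Metric metric

  members : Triple (length σ) → List (Fin (length σ))
  members t = i₁ t ∷ i₂ t ∷ i₃ t ∷ []

  ArrivedBy : ℚ → Fin (length σ) → Set
  ArrivedBy m i = time (lookup σ i) ≤ℚ m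

  wait : ℚ → Fin (length σ) → ℚ
  wait m i = m - time (lookup σ i)

  feasible⇒arrived : ∀ {t} → TripleFeasible d σ t → All (ArrivedBy (mtime t)) (members t)
  feasible⇒arrived (arr₁ , arr₂ , arr₃) = arr₁ ∷ arr₂ ∷ arr₃ ∷ []

  tripleCost-swap₁₂ : ∀ i j k m → tripleCost d σ (tri i j k m) ≡ tripleCost d σ (tri j i k m)
  tripleCost-swap₁₂ i j k m =
    cong₂ _+_ (perm₁₂ _ _ _) (cong (_+ wait m k) (+-comm (wait m i) (wait m j)))

  tripleCost-swap₂₃ : ∀ i j k m → tripleCost d σ (tri i j k m) ≡ tripleCost d σ (tri i k j m)
  tripleCost-swap₂₃ i j k m = cong₂ _+_ (perm₂₃ _ _ _) (xy∙z≈xz∙y (wait m i) (wait m j) (wait m k))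

  rotate : ∀ t {s} → s ∈ members t →
           ∃₂ λ j k → members t ↭ s ∷ j ∷ k ∷ []
                    × tripleCost d σ t ≡ tripleCost d σ (tri s j k (mtime t))
  rotate (tri i j k m) (here refl)                 = j , k , ↭-refl , refl
  rotate (tri i j k m) (there (here refl))         =
    i , k , ↭-swap i j ↭-refl , tripleCost-swap₁₂ i j k m
  rotate (tri i j k m) (there (there (here refl))) =
    i , j , ↭-trans (↭-prep i (↭-swap j k ↭-refl)) (↭-swap i k ↭-refl) ,
    trans (tripleCost-swap₂₃ i j k m) (tripleCost-swap₁₂ i k j m)

  wait-nonNeg : ∀ {m i} → ArrivedBy m i → 0ℚ ≤ℚ wait m i
  wait-nonNeg = p≤q⇒0≤q-p

  space≤tripleCost : ∀ {i j k m} → All (ArrivedBy m) (i ∷ j ∷ k ∷ []) →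
                     d (loc (lookup σ i)) (loc (lookup σ j)) (loc (lookup σ k))
                       ≤ℚ tripleCost d σ (tri i j k m)
  space≤tripleCost (arrᵢ ∷ arrⱼ ∷ arrₖ ∷ []) =
    p≤p+q (+-mono-≤ (+-mono-≤ (wait-nonNeg arrᵢ) (wait-nonNeg arrⱼ)) (wait-nonNeg arrₖ))

  waits≤tripleCost : ∀ {i j k m} → ArrivedBy m i → wait m j + wait m k ≤ℚ tripleCost d σ (tri i j k m)
  waits≤tripleCost {k = k} {m} arrᵢ =
    ≤-trans (+-monoˡ-≤ (wait m k) (p≤q+p (wait-nonNeg arrᵢ))) (p≤q+p (nonneg _ _ _))

  tripleCost-nonNeg : ∀ {t} → TripleFeasible d σ t → 0ℚ ≤ℚ tripleCost d σ t
  tripleCost-nonNeg {tri _ _ _ _} feasible =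
    ≤-trans (nonneg _ _ _) (space≤tripleCost (feasible⇒arrived feasible))

  record Companions (t : Triple (length σ)) (s : Fin (length σ)) : Set where
    field
      j k        : Fin (length σ)
      j∈t        : j ∈ members t
      k∈t        : k ∈ members t
      j≢s        : j ≢ s
      k≢s        : k ≢ s
      j≢k        : j ≢ k
      waits≤cost : wait (mtime t) j + wait (mtime t) k ≤ℚ tripleCost d σ t

  companions : ∀ {t s} → All (ArrivedBy (mtime t)) (members t) → Unique (members t) →
               s ∈ members t → Companions t s
  companions {t} arrived distinct s∈t with rotate t s∈t
  ... | j , k , t↭ , cost≡ with Unique-resp-↭ t↭ distinct | All-resp-↭ t↭ arrived
  ...   | (s≢j ∷ s≢k ∷ []) ∷ (j≢k ∷ []) ∷ [] ∷ [] | arrₛ ∷ _ = record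
    { j          = j
    ; k          = k
    ; j∈t        = ∈-resp-↭ (↭-sym t↭) (there (here refl))
    ; k∈t        = ∈-resp-↭ (↭-sym t↭) (there (there (here refl)))
    ; j≢s        = s≢j ∘ sym
    ; k≢s        = s≢k ∘ sym
    ; j≢k        = j≢k
    ; waits≤cost = subst (_ ≤ℚ_) (sym cost≡) (waits≤tripleCost arrₛ)
    }

module LowerBound
  {V : Set ℓ} {d : V → V → V → ℚ} (metric : Is2Metric d)
  {v₁ v₂ v₃ : V} (v₂≢v₃ : v₂ ≢ v₃) (d≡1 : d v₁ v₂ v₃ ≡ 1ℚ)
  (σ : List (Request V)) (τ T : ℚ) (3τ≤1 : ℕ→ℚ 3 * τ ≤ℚ 1ℚ)
  (w a b : Fin (length σ)) (a-new : lookup σ a ≡ req v₂ T) (b-new : lookup σ b ≡ req v₃ T)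
  (at-v₁ : ∀ i → i ≢ a → i ≢ b → loc (lookup σ i) ≡ v₁)
  (early : ∀ i → i ≢ a → i ≢ b → i ≢ w → time (lookup σ i) + τ ≤ℚ T)
  where

  open Is2Metric metric
  open Matching metric σ
  open DecMembership (_≟ᶠ_ {length σ}) using (_∈?_)
  open ≤-Reasoning

  Early : Fin (length σ) → Set
  Early i = time (lookup σ i) + τ ≤ℚ T

  a-at-T : time (lookup σ a) ≡ T
  a-at-T = cong time a-new

  b-at-T : time (lookup σ b) ≡ T
  b-at-T = cong time b-new

  a≢b : a ≢ b
  a≢b refl = v₂≢v₃ (cong loc (trans (sym a-new) b-new))

  d[v₂,v₃,v₁]≡1 : ∀ {x y z} → x ≡ v₂ → y ≡ v₃ → z ≡ v₁ → d x y z ≡ 1ℚ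
  d[v₂,v₃,v₁]≡1 refl refl refl = trans (perm₂₃ v₂ v₃ v₁) (trans (perm₁₂ v₂ v₁ v₃) d≡1)

  d[v₂,v₁,v₃]≡1 : ∀ {x y z} → x ≡ v₂ → y ≡ v₁ → z ≡ v₃ → d x y z ≡ 1ℚ
  d[v₂,v₁,v₃]≡1 refl refl refl = trans (perm₁₂ v₂ v₁ v₃) d≡1

  module _ {M : List (Triple (length σ))}
           (M↭ : indices M ↭ allFin (length σ)) (feasible : All (TripleFeasible d σ) M) where

    distinct-indices : Unique (indices M)
    distinct-indices = Unique-resp-↭ (↭-sym M↭) (allFin⁺ _)

    arrived : ∀ {t} → t ∈ M → All (ArrivedBy (mtime t)) (members t)
    arrived t∈M = feasible⇒arrived (All.lookup feasible t∈M)

    distinct : ∀ {t} → t ∈ M → Unique (members t)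
    distinct = Unique-concatMap⁻ members distinct-indices

    costs-nonNeg : All (λ t → 0ℚ ≤ℚ tripleCost d σ t) M
    costs-nonNeg = All.map tripleCost-nonNeg feasible

    matched : ∀ i → ∃ λ t → t ∈ M × i ∈ members t
    matched i = find (∈-concatMap⁻ members (∈-resp-↭ (↭-sym M↭) (∈-allFin i)))

    T≤mtime : ∀ {t s} → t ∈ M → s ∈ members t → time (lookup σ s) ≡ T → T ≤ℚ mtime t
    T≤mtime {t} t∈M s∈t s-at-T = subst (_≤ℚ mtime t) s-at-T (All.lookup (arrived t∈M) s∈t)

    τ≤wait : ∀ {m x} → T ≤ℚ m → Early x → τ ≤ℚ wait m x
    τ≤wait T≤m early-x = p+r≤q⇒r≤q-p (≤-trans early-x T≤m)

    1≤cost : ∀ {t} → t ∈ M → a ∈ members t → b ∈ members t → 1ℚ ≤ℚ tripleCost d σ t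
    1≤cost {t} t∈M a∈t b∈t with rotate t a∈t
    ... | j , k , t↭ , cost≡
      with Unique-resp-↭ t↭ (distinct t∈M) | ∈-resp-↭ t↭ b∈t | All-resp-↭ t↭ (arrived t∈M)
    ...   | _ | here b≡a | _ = ⊥-elim (a≢b (sym b≡a))
    ...   | (_ ∷ a≢k ∷ []) ∷ (b≢k ∷ []) ∷ [] ∷ [] | there (here refl) | arr = begin
      1ℚ                                   ≡⟨ d[v₂,v₃,v₁]≡1 (cong loc a-new) (cong loc b-new)
                                                            (at-v₁ k (a≢k ∘ sym) (b≢k ∘ sym)) ⟨
      d _ _ _                              ≤⟨ space≤tripleCost arr ⟩
      tripleCost d σ (tri a b k (mtime t)) ≡⟨ cost≡ ⟨
      tripleCost d σ t                     ∎
    ...   | (a≢j ∷ _ ∷ []) ∷ (j≢b ∷ []) ∷ [] ∷ [] | there (there (here refl)) | arr = begin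
      1ℚ                                   ≡⟨ d[v₂,v₁,v₃]≡1 (cong loc a-new) (at-v₁ j (a≢j ∘ sym) j≢b)
                                                            (cong loc b-new) ⟨
      d _ _ _                              ≤⟨ space≤tripleCost arr ⟩
      tripleCost d σ (tri a j b (mtime t)) ≡⟨ cost≡ ⟨
      tripleCost d σ t                     ∎

    τ+τ≤cost : ∀ {t s} → t ∈ M → s ∈ members t → time (lookup σ s) ≡ T →
               (∀ {x} → x ∈ members t → x ≢ s → Early x) → τ + τ ≤ℚ tripleCost d σ t
    τ+τ≤cost {t} t∈M s∈t s-at-T early-others =
      ≤-trans (+-mono-≤ (τ≤wait T≤m (early-others j∈t j≢s)) (τ≤wait T≤m (early-others k∈t k≢s)))
              waits≤cost
      where
        open Companions (companions (arrived t∈M) (distinct t∈M) s∈t)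
        T≤m : T ≤ℚ mtime t
        T≤m = T≤mtime t∈M s∈t s-at-T

    τ≤cost : ∀ {t s} → t ∈ M → s ∈ members t → time (lookup σ s) ≡ T →
             (∀ {x} → x ∈ members t → x ≢ s → x ≢ w → Early x) → τ ≤ℚ tripleCost d σ t
    τ≤cost {t} t∈M s∈t s-at-T early-others = ≤-trans (one-waits-τ (j ≟ᶠ w)) waits≤cost
      where
        open Companions (companions (arrived t∈M) (distinct t∈M) s∈t)
        T≤m : T ≤ℚ mtime t
        T≤m = T≤mtime t∈M s∈t s-at-T
        one-waits-τ : Dec (j ≡ w) → τ ≤ℚ wait (mtime t) j + wait (mtime t) k
        one-waits-τ (yes j≡w) =
          ≤-trans (τ≤wait T≤m (early-others k∈t k≢s (λ k≡w → j≢k (trans j≡w (sym k≡w)))))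
                  (p≤q+p (wait-nonNeg (All.lookup (arrived t∈M) j∈t)))
        one-waits-τ (no j≢w) =
          ≤-trans (τ≤wait T≤m (early-others j∈t j≢s j≢w))
                  (p≤p+q (wait-nonNeg (All.lookup (arrived t∈M) k∈t)))

    3τ≤cost-apart : ∀ {t₁ t₂} → t₁ ∈ M → t₂ ∈ M → Disjoint (members t₁) (members t₂) →
                    a ∈ members t₁ → b ∈ members t₂ →
                    ℕ→ℚ 3 * τ ≤ℚ tripleCost d σ t₁ + tripleCost d σ t₂
    3τ≤cost-apart {t₁} {t₂} t₁∈M t₂∈M apart a∈t₁ b∈t₂ with w ∈? members t₁
    ... | no w∉t₁ = begin
      ℕ→ℚ 3 * τ                               ≡⟨ 3*τ≡τ+τ+τ τ ⟩
      τ + τ + τ                               ≤⟨ +-mono-≤ (τ+τ≤cost t₁∈M a∈t₁ a-at-T early₁)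
                                                          (τ≤cost t₂∈M b∈t₂ b-at-T early₂) ⟩
      tripleCost d σ t₁ + tripleCost d σ t₂   ∎
      where
        early₁ : ∀ {x} → x ∈ members t₁ → x ≢ a → Early x
        early₁ x∈t₁ x≢a =
          early _ x≢a (λ { refl → apart (x∈t₁ , b∈t₂) }) (λ { refl → w∉t₁ x∈t₁ })
        early₂ : ∀ {x} → x ∈ members t₂ → x ≢ b → x ≢ w → Early x
        early₂ x∈t₂ = early _ (λ { refl → apart (a∈t₁ , x∈t₂) })
    ... | yes w∈t₁ = begin
      ℕ→ℚ 3 * τ                               ≡⟨ 3*τ≡τ+[τ+τ] τ ⟩
      τ + (τ + τ)                             ≤⟨ +-mono-≤ (τ≤cost t₁∈M a∈t₁ a-at-T early₁)
                                                          (τ+τ≤cost t₂∈M b∈t₂ b-at-T early₂) ⟩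
      tripleCost d σ t₁ + tripleCost d σ t₂   ∎
      where
        early₁ : ∀ {x} → x ∈ members t₁ → x ≢ a → x ≢ w → Early x
        early₁ x∈t₁ x≢a = early _ x≢a (λ { refl → apart (x∈t₁ , b∈t₂) })
        early₂ : ∀ {x} → x ∈ members t₂ → x ≢ b → Early x
        early₂ x∈t₂ x≢b =
          early _ (λ { refl → apart (a∈t₁ , x∈t₂) }) x≢b (λ { refl → apart (w∈t₁ , x∈t₂) })

    3τ≤cost : ℕ→ℚ 3 * τ ≤ℚ cost d σ M
    3τ≤cost with matched a | matched b
    ... | t₁ , t₁∈M , a∈t₁ | t₂ , t₂∈M , b∈t₂ with b ∈? members t₁
    ...   | yes b∈t₁ = begin
      ℕ→ℚ 3 * τ          ≤⟨ 3τ≤1 ⟩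
      1ℚ                 ≤⟨ 1≤cost t₁∈M a∈t₁ b∈t₁ ⟩
      tripleCost d σ t₁  ≤⟨ ∑-≥-term costs-nonNeg t₁∈M ⟩
      cost d σ M         ∎
    ...   | no b∉t₁ = begin
      ℕ→ℚ 3 * τ                               ≤⟨ 3τ≤cost-apart t₁∈M t₂∈M apart a∈t₁ b∈t₂ ⟩
      tripleCost d σ t₁ + tripleCost d σ t₂   ≤⟨ ∑-≥-two-terms costs-nonNeg t₁∈M t₂∈M t₁≢t₂ ⟩
      cost d σ M                              ∎
      where
        t₁≢t₂ : t₁ ≢ t₂
        t₁≢t₂ refl = b∉t₁ b∈t₂
        apart : Disjoint (members t₁) (members t₂)
        apart = Unique-concatMap⇒Disjoint members distinct-indices t₁∈M t₂∈M t₁≢t₂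

  3τ≤solution-cost : ∀ M → IsSolution d σ M → ℕ→ℚ 3 * τ ≤ℚ cost d σ M
  3τ≤solution-cost M (M↭ , feasible) = 3τ≤cost M↭ feasible

module UpperBound {V : Set ℓ} {d : V → V → V → ℚ} (metric : Is2Metric d) where
  open Is2Metric metric

  SolutionOfCost : List (Request V) → ℚ → Set
  SolutionOfCost σ c = Σ (List (Triple (length σ))) λ M → IsSolution d σ M × cost d σ M ≡ c

  shift₃ : ∀ {n} → Triple n → Triple (3 ℕ.+ n)
  shift₃ (tri i j k m) = tri (3 ↑ʳ i) (3 ↑ʳ j) (3 ↑ʳ k) m

  indices-shift₃ : ∀ {n} (M : List (Triple n)) → indices (map shift₃ M) ≡ map (3 ↑ʳ_) (indices M)
  indices-shift₃ []                = refl
  indices-shift₃ (tri i j k _ ∷ M) =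
    cong (λ is → (3 ↑ʳ i) ∷ (3 ↑ʳ j) ∷ (3 ↑ʳ k) ∷ is) (indices-shift₃ M)

  allFin-3+ : ∀ n → allFin (3 ℕ.+ n) ≡ # 0 ∷ # 1 ∷ # 2 ∷ map (3 ↑ʳ_) (allFin n)
  allFin-3+ n = cong (λ is → # 0 ∷ # 1 ∷ # 2 ∷ is) (sym (map-tabulate id (3 ↑ʳ_)))

  module _ {r₀ r₁ r₂ : Request V} {ys : List (Request V)} where

    cost-shift₃ : ∀ M → cost d (r₀ ∷ r₁ ∷ r₂ ∷ ys) (map shift₃ M) ≡ cost d ys M
    cost-shift₃ []                = refl
    cost-shift₃ (tri i j k m ∷ M) = cong (λ c → tripleCost d ys (tri i j k m) + c) (cost-shift₃ M)

    feasible-shift₃ : ∀ {M} → All (TripleFeasible d ys) M →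
                      All (TripleFeasible d (r₀ ∷ r₁ ∷ r₂ ∷ ys)) (map shift₃ M)
    feasible-shift₃ {[]}                []                  = []
    feasible-shift₃ {tri _ _ _ _ ∷ _} (feasible ∷ feasibles) = feasible ∷ feasible-shift₃ feasibles

    prepend-triple : ∀ {c} m → All (λ r → time r ≤ℚ m) (r₀ ∷ r₁ ∷ r₂ ∷ []) → SolutionOfCost ys c →
                     SolutionOfCost (r₀ ∷ r₁ ∷ r₂ ∷ ys)
                       (tripleCost d (r₀ ∷ r₁ ∷ r₂ ∷ ys) (tri (# 0) (# 1) (# 2) m) + c)
    prepend-triple m (arr₀ ∷ arr₁ ∷ arr₂ ∷ []) (M , (M↭ , feasible) , cost≡c) =
      tri (# 0) (# 1) (# 2) m ∷ map shift₃ M ,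
      (indices↭ , (arr₀ , arr₁ , arr₂) ∷ feasible-shift₃ feasible) ,
      cong (λ c′ → tripleCost d (r₀ ∷ r₁ ∷ r₂ ∷ ys) (tri (# 0) (# 1) (# 2) m) + c′)
           (trans (cost-shift₃ M) cost≡c)
      where
        open PermutationReasoning
        indices↭ : # 0 ∷ # 1 ∷ # 2 ∷ indices (map shift₃ M) ↭ allFin (3 ℕ.+ length ys)
        indices↭ = begin
          # 0 ∷ # 1 ∷ # 2 ∷ indices (map shift₃ M)
            ≡⟨ cong (λ is → # 0 ∷ # 1 ∷ # 2 ∷ is) (indices-shift₃ M) ⟩
          # 0 ∷ # 1 ∷ # 2 ∷ map (3 ↑ʳ_) (indices M)
            ↭⟨ ↭-prep _ (↭-prep _ (↭-prep _ (map⁺ (3 ↑ʳ_) M↭))) ⟩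
          # 0 ∷ # 1 ∷ # 2 ∷ map (3 ↑ʳ_) (allFin (length ys))
            ≡⟨ allFin-3+ (length ys) ⟨
          allFin (3 ℕ.+ length ys)
            ∎

  prepend-P₁ : ∀ {ys c} v q → SolutionOfCost ys c → SolutionOfCost (P₁ v q ++ ys) c
  prepend-P₁ {c = c} v q solution =
    subst (SolutionOfCost _) matched-on-arrival
          (prepend-triple q (≤-refl ∷ ≤-refl ∷ ≤-refl ∷ []) solution)
    where
      no-waiting : ∀ q c → 0ℚ + (q - q + (q - q) + (q - q)) + c ≡ c
      no-waiting = solve-∀ ℚ-ring
      matched-on-arrival : d v v v + (q - q + (q - q) + (q - q)) + c ≡ c
      matched-on-arrival =
        trans (cong (λ x → x + (q - q + (q - q) + (q - q)) + c) (zero-if v v v (inj₁ refl)))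
              (no-waiting q c)

  prepend-P₁phases : ∀ {ys c} v k → SolutionOfCost ys c → SolutionOfCost (P₁phases v k ++ ys) c
  prepend-P₁phases          v ℕ.zero    solution = solution
  prepend-P₁phases {ys} {c} v (ℕ.suc k) solution =
    subst (λ σ → SolutionOfCost σ c) (sym (++-assoc (P₁phases v k) (P₁ v (ℕ→ℚ k)) ys))
          (prepend-P₁phases v k (prepend-P₁ v (ℕ→ℚ k) solution))

  last-phase : ∀ (v₁ v₂ v₃ : V) q {τ} → 0ℚ ≤ℚ τ →
               SolutionOfCost (P₁ v₁ q ++ P₂ v₁ v₂ v₃ (q + τ)) (ℕ→ℚ 3 * τ)
  last-phase v₁ v₂ v₃ q {τ} 0≤τ =
    tri (# 0) (# 1) (# 4) T ∷ tri (# 2) (# 3) (# 5) T ∷ [] ,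
    (indices↭ , (q≤T , q≤T , ≤-refl) ∷ (q≤T , ≤-refl , ≤-refl) ∷ []) ,
    cost≡3τ
    where
      T : ℚ
      T = q + τ
      q≤T : q ≤ℚ T
      q≤T = p≤p+q 0≤τ
      indices↭ : # 0 ∷ # 1 ∷ # 4 ∷ # 2 ∷ # 3 ∷ # 5 ∷ [] ↭ allFin 6
      indices↭ = ↭-prep _ (↭-prep _ (↭-trans (↭-swap _ _ ↭-refl) (↭-prep _ (↭-swap _ _ ↭-refl))))
      waits≡3τ : ∀ q τ → 0ℚ + ((q + τ - q) + (q + τ - q) + (q + τ - (q + τ)))
                          + (0ℚ + ((q + τ - q) + (q + τ - (q + τ)) + (q + τ - (q + τ))) + 0ℚ)
                        ≡ ℕ→ℚ 3 * τ
      waits≡3τ = solve-∀ ℚ-ring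
      W₁ W₂ : ℚ
      W₁ = T - q + (T - q) + (T - T)
      W₂ = T - q + (T - T) + (T - T)
      cost≡3τ : d v₁ v₁ v₂ + W₁ + (d v₁ v₁ v₃ + W₂ + 0ℚ) ≡ ℕ→ℚ 3 * τ
      cost≡3τ = begin
        d v₁ v₁ v₂ + W₁ + (d v₁ v₁ v₃ + W₂ + 0ℚ) ≡⟨ cong₂ (λ x y → x + W₁ + (y + W₂ + 0ℚ))
                                                           (zero-if v₁ v₁ v₂ (inj₁ refl))
                                                           (zero-if v₁ v₁ v₃ (inj₁ refl)) ⟩
        0ℚ + W₁ + (0ℚ + W₂ + 0ℚ)                 ≡⟨ waits≡3τ q τ ⟩
        ℕ→ℚ 3 * τ                                ∎
        where open ≡-Reasoning

  requestSeq-solution : ∀ (v₁ v₂ v₃ : V) {τ} m → 0ℚ ≤ℚ τ →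
                        SolutionOfCost (requestSeq v₁ v₂ v₃ τ (ℕ.suc m)) (ℕ→ℚ 3 * τ)
  requestSeq-solution v₁ v₂ v₃ {τ} m 0≤τ =
    subst (λ σ → SolutionOfCost σ (ℕ→ℚ 3 * τ))
          (sym (++-assoc (P₁phases v₁ m) (P₁ v₁ (ℕ→ℚ m)) (P₂ v₁ v₂ v₃ (ℕ→ℚ m + τ))))
          (prepend-P₁phases v₁ m (last-phase v₁ v₂ v₃ (ℕ→ℚ m) 0≤τ))

P₁phases-before : ∀ {V : Set ℓ} (v : V) {m k} → k ℕ.≤ ℕ.suc m →
                  All (λ r → loc r ≡ v × time r ≤ℚ ℕ→ℚ m) (P₁phases v k)
P₁phases-before v {k = ℕ.zero}  _            = []
P₁phases-before v {k = ℕ.suc k} (ℕ.s≤s k≤m) =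
  All.++⁺ (P₁phases-before v (ℕ.m≤n⇒m≤1+n k≤m)) (at-v ∷ at-v ∷ at-v ∷ [])
  where
    at-v : v ≡ v × ℕ→ℚ k ≤ℚ _
    at-v = refl , ℕ→ℚ-mono-≤ k≤m

module FinalPhase {V : Set ℓ} (v₁ v₂ v₃ : V) (earlier : List (Request V)) {t₀ : ℚ}
                  (earlier-at-v₁ : All (λ r → loc r ≡ v₁ × time r ≤ℚ t₀) earlier) (τ : ℚ) where

  T : ℚ
  T = t₀ + τ

  σ : List (Request V)
  σ = earlier ++ P₂ v₁ v₂ v₃ T

  new : Fin 3 → Fin (length σ)
  new = index-++ʳ earlier

  w a b : Fin (length σ)
  w = new (# 0)
  a = new (# 1)
  b = new (# 2)

  lookup-new : ∀ j → lookup σ (new j) ≡ lookup (P₂ v₁ v₂ v₃ T) j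
  lookup-new = lookup-index-++ʳ earlier

  at-v₁ : ∀ i → i ≢ a → i ≢ b → loc (lookup σ i) ≡ v₁
  at-v₁ i i≢a i≢b with lookup-++-cases earlier-at-v₁ i
  ... | inj₁ (at , _)                = at
  ... | inj₂ (zero , refl)           = cong loc (lookup-new (# 0))
  ... | inj₂ (suc zero , refl)       = ⊥-elim (i≢a refl)
  ... | inj₂ (suc (suc zero) , refl) = ⊥-elim (i≢b refl)

  early : ∀ i → i ≢ a → i ≢ b → i ≢ w → time (lookup σ i) + τ ≤ℚ T
  early i i≢a i≢b i≢w with lookup-++-cases earlier-at-v₁ i
  ... | inj₁ (_ , before)            = +-monoˡ-≤ τ before
  ... | inj₂ (zero , refl)           = ⊥-elim (i≢w refl)
  ... | inj₂ (suc zero , refl)       = ⊥-elim (i≢a refl)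
  ... | inj₂ (suc (suc zero) , refl) = ⊥-elim (i≢b refl)

lemma1 : ∀ {a} {V : Set a} (d : V → V → V → ℚ) → Is2Metric d →
         (v₁ v₂ v₃ : V) → v₁ ≢ v₂ → v₁ ≢ v₃ → v₂ ≢ v₃ → d v₁ v₂ v₃ ≡ 1ℚ →
         (r : ℕ) → 1 ≤ r → (τ : ℚ) → 0ℚ < τ → τ < + 1 / 3 →
         (k : ℕ) → 1 ≤ k → k ≤ r →
         OptCost d (requestSeq v₁ v₂ v₃ τ k) (ℕ→ℚ 3 * τ)
lemma1 d metric v₁ v₂ v₃ _ _ v₂≢v₃ d≡1 _ _ τ 0<τ τ<⅓ (ℕ.suc m) _ _ =
  UpperBound.requestSeq-solution metric v₁ v₂ v₃ m (<⇒≤ 0<τ) ,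
  LowerBound.3τ≤solution-cost metric v₂≢v₃ d≡1 σ τ T (3*τ≤1 τ<⅓) w a b
    (lookup-new (# 1)) (lookup-new (# 2)) at-v₁ early
  where open FinalPhase v₁ v₂ v₃ (P₁phases v₁ (ℕ.suc m)) (P₁phases-before v₁ {m} ℕ.≤-refl) τ
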